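{- Let $k \ge 3$ and $m,n \ge 2$ be integers. The $k$-graph $\mathcal{L}_{m,n}$ is $F^k$-free.
   Context: $\mathcal{L}_{m,n}$ is the $k$-graph with vertex set $[m]\times[n]$ whose edges are all sets $\{(x_1,y_1),(x_1,y_2),(x_2,y_2),\dots,(x_{k-1},y_2)\}$ with $x_1 < x_2 < \cdots < x_{k-1}$ in $[m]$ and $y_1 > y_2$ in $[n]$. The $k$-Fan $F^k$ is the $k$-graph consisting of $k+1$ edges $E_1,\dots,E_k,E$ such that $E_i \cap E_j = \{v\}$ for all $1 \le i < j \le k$, where $v \notin E$, and $|E_i \cap E| = 1$ for $1 \le i \le k$. $F^k$-free means containing no copy of $F^k$ as a subgraph. -}

module Defs where

open import Data.Nat using (ℕ; _∸_)
open import Data.Fin using (Fin) renaming (_<_ to _<ᶠ_)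
open import Data.Product using (Σ; _×_; _,_; ∃; ∃-syntax)
open import Data.Sum using (_⊎_)
open import Relation.Binary.PropositionalEquality using (_≡_; _≢_)
open import Relation.Nullary using (¬_)
open import Function.Bundles using (_⇔_)

VSet : Set → Set₁
VSet V = V → Set

KGraph : Set → Set₁
KGraph V = VSet V → Set

-- Vertex set of L_{m,n}: [m] × [n]  (coordinates 0-indexed).
LVertex : ℕ → ℕ → Set
LVertex m n = Fin m × Fin n

-- The edge {(x₁,y₁),(x₁,y₂),(x₂,y₂),…,(x_{k-1},y₂)} determined by
-- x₁ and xs = (x₂,…,x_{k-1}) (indexed by Fin (k ∸ 2)), y₁, y₂.
LEdgeSet : ∀ {m n} k → Fin m → (Fin (k ∸ 2) → Fin m) → Fin n → Fin n
         → VSet (LVertex m n)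
LEdgeSet k x₁ xs y₁ y₂ u =
  (u ≡ (x₁ , y₁)) ⊎ (u ≡ (x₁ , y₂)) ⊎ (∃[ i ] u ≡ (xs i , y₂))

L : (k m n : ℕ) → KGraph (LVertex m n)
L k m n S =
  ∃[ x₁ ] ∃[ xs ] ∃[ y₁ ] ∃[ y₂ ]
    ( (∀ i → x₁ <ᶠ xs i)
    × (∀ i j → i <ᶠ j → xs i <ᶠ xs j)
    × (y₂ <ᶠ y₁)
    × (∀ u → S u ⇔ LEdgeSet k x₁ xs y₁ y₂ u) )

ContainsFan : ∀ {V} (k : ℕ) → KGraph V → Set₁
ContainsFan {V} k H =
  Σ (Fin k → VSet V) λ Es → Σ (VSet V) λ E → Σ V λ v →
    ( (∀ (i : Fin k) → H (Es i))
    × H E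
    × (∀ (i j : Fin k) → i ≢ j → ∀ u → (Es i u × Es j u) ⇔ (u ≡ v))
    × ¬ E v
    × (∀ (i : Fin k) → Σ V λ w → ∀ u → (Es i u × E u) ⇔ (u ≡ w)) )

FanFree : ∀ {V} (k : ℕ) → KGraph V → Set₁
FanFree k H = ¬ ContainsFan k H

-- Let the fan have centre v = (p, q), and let its edge E have apex (a, b) and base
-- row d < b starting with (a, d), (x₂, d).  Two spokes share only v ∉ E, so the k
-- spokes meet E in k distinct vertices, i.e. every vertex of E is met by its own
-- spoke.  In an edge of L a vertex (x′, y′) above another vertex (x, y) is the apex,
-- and then x′ ≤ x and (x′, y) is in the edge.  Every spoke contains v.  If q = d the
-- spoke of (a, b) also contains (a, d) ∈ E; if q > d the spokes of (a, d) and (x₂, d)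
-- share (p, d) ≠ v; if q < d the spokes of (a, b) and (a, d) share (a, q), forcing
-- p = a, while the spoke of (x₂, d) forces a < x₂ ≤ p.
module Submission where

open import Defs
open import Data.Nat using (ℕ; _+_; _≤_; suc; s≤s; _∸_)
import Data.Nat.Properties as ℕ
open import Data.Fin using (Fin; punchOut) renaming (_<_ to _<ᶠ_; _≤_ to _≤ᶠ_)
import Data.Fin as Fin
import Data.Fin.Properties as Fin
open import Data.Product using (Σ; ∃; _×_; _,_; proj₁; proj₂)
open import Data.Sum using (_⊎_; inj₁; inj₂)
open import Data.Empty using (⊥; ⊥-elim)
open import Relation.Nullary using (¬_; yes; no; contradiction)
open import Relation.Binary.Definitions using (tri<; tri≈; tri>)
open import Relation.Binary.PropositionalEquality
open import Function.Base using (_∘_)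
open import Function.Definitions using (Injective)
open import Function.Bundles using (_⇔_; Equivalence)
open Equivalence using (to; from)

injective⇒surjective : ∀ {n} {f : Fin n → Fin n} → Injective _≡_ _≡_ f →
                       ∀ y → ∃ λ i → f i ≡ y
injective⇒surjective {f = f} f-inj y with Fin.any? (λ i → f i Fin.≟ y)
... | yes hit = hit
injective⇒surjective {suc n} {f} f-inj y | no miss =
  ⊥-elim (Fin.<⇒notInjective ℕ.≤-refl squeeze-injective)
  where
  missed : ∀ i → y ≢ f i
  missed i = miss ∘ (i ,_) ∘ sym

  squeeze : Fin (suc n) → Fin n
  squeeze i = punchOut (missed i)

  squeeze-injective : Injective _≡_ _≡_ squeeze
  squeeze-injective {i} {j} = f-inj ∘ Fin.punchOut-injective (missed i) (missed j)

module _ {m n} (k : ℕ) (x₁ : Fin m) (xs : Fin (k ∸ 2) → Fin m) (y₁ y₂ : Fin n) where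

  L-vertex : Fin (2 + (k ∸ 2)) → LVertex m n
  L-vertex Fin.zero             = x₁ , y₁
  L-vertex (Fin.suc Fin.zero)    = x₁ , y₂
  L-vertex (Fin.suc (Fin.suc i)) = xs i , y₂

  L-vertex∈LEdgeSet : ∀ y → LEdgeSet k x₁ xs y₁ y₂ (L-vertex y)
  L-vertex∈LEdgeSet Fin.zero             = inj₁ refl
  L-vertex∈LEdgeSet (Fin.suc Fin.zero)    = inj₂ (inj₁ refl)
  L-vertex∈LEdgeSet (Fin.suc (Fin.suc i)) = inj₂ (inj₂ (i , refl))

  LEdgeSet⇒L-vertex : ∀ {u} → LEdgeSet k x₁ xs y₁ y₂ u → ∃ λ y → L-vertex y ≡ u
  LEdgeSet⇒L-vertex (inj₁ refl)             = Fin.zero , refl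
  LEdgeSet⇒L-vertex (inj₂ (inj₁ refl))       = Fin.suc Fin.zero , refl
  LEdgeSet⇒L-vertex (inj₂ (inj₂ (i , refl))) = Fin.suc (Fin.suc i) , refl

  apex-or-base : (∀ i → x₁ <ᶠ xs i) → ∀ {x y} → LEdgeSet k x₁ xs y₁ y₂ (x , y) →
                 (x , y) ≡ (x₁ , y₁) ⊎ (y ≡ y₂ × x₁ ≤ᶠ x)
  apex-or-base _     (inj₁ eq)                = inj₁ eq
  apex-or-base _     (inj₂ (inj₁ refl))       = inj₂ (refl , Fin.≤-refl)
  apex-or-base x₁<xs (inj₂ (inj₂ (i , refl))) = inj₂ (refl , ℕ.<⇒≤ (x₁<xs i))

-- The upper vertex must be the apex (x₁, y₁) and the lower one lies on the base row
-- to the right of x₁, so (x′, y) is the base corner (x₁, y₂).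
L-corner : ∀ {k m n} {S : VSet (LVertex m n)} → L k m n S →
           ∀ {x y x′ y′} → S (x , y) → S (x′ , y′) → y <ᶠ y′ →
           x′ ≤ᶠ x × S (x′ , y)
L-corner {k} (x₁ , xs , y₁ , y₂ , x₁<xs , _ , y₂<y₁ , S⇔) s s′ y<y′
  with apex-or-base k x₁ xs y₁ y₂ x₁<xs (to (S⇔ _) s)
     | apex-or-base k x₁ xs y₁ y₂ x₁<xs (to (S⇔ _) s′)
... | inj₁ refl         | inj₁ refl = contradiction y<y′ (Fin.<-irrefl refl)
... | inj₂ (refl , x₁≤) | inj₁ refl = x₁≤ , from (S⇔ _) (inj₂ (inj₁ refl))
... | inj₁ refl         | inj₂ (refl , _) = contradiction y₂<y₁ (Fin.<-asym y<y′)
... | inj₂ (refl , _)   | inj₂ (refl , _) = contradiction y<y′ (Fin.<-irrefl refl)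

module Fan {V : Set} {k : ℕ} {Es : Fin k → VSet V} {E : VSet V} {v : V}
  (spokes-meet : ∀ i j → i ≢ j → ∀ u → (Es i u × Es j u) ⇔ (u ≡ v))
  (v∉E : ¬ E v)
  (meets : ∀ i → Σ V λ w → ∀ u → (Es i u × E u) ⇔ (u ≡ w))
  where

  meet : Fin k → V
  meet i = proj₁ (meets i)

  meet∈spoke : ∀ i → Es i (meet i)
  meet∈spoke i = proj₁ (from (proj₂ (meets i) (meet i)) refl)

  meet∈E : ∀ i → E (meet i)
  meet∈E i = proj₂ (from (proj₂ (meets i) (meet i)) refl)

  meet-unique : ∀ {i u} → Es i u → E u → u ≡ meet i
  meet-unique {i} {u} s e = to (proj₂ (meets i) u) (s , e)

  center∈spoke : ∀ {i j} → i ≢ j → Es i v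
  center∈spoke {i} {j} i≢j = proj₁ (from (spokes-meet i j i≢j v) refl)

  shared⇒center : ∀ {i j u} → meet i ≢ meet j → Es i u → Es j u → u ≡ v
  shared⇒center {i} {j} {u} meets≢ sᵢ sⱼ with i Fin.≟ j
  ... | yes refl = contradiction refl meets≢
  ... | no i≢j   = to (spokes-meet i j i≢j u) (sᵢ , sⱼ)

  meet-injective : Injective _≡_ _≡_ meet
  meet-injective {i} {j} meetᵢ≡meetⱼ with i Fin.≟ j
  ... | yes i≡j = i≡j
  ... | no i≢j  = contradiction (subst E meetᵢ≡v (meet∈E i)) v∉E
    where
    meetᵢ≡v : meet i ≡ v
    meetᵢ≡v = to (spokes-meet i j i≢j (meet i))
                 (meet∈spoke i , subst (Es j) (sym meetᵢ≡meetⱼ) (meet∈spoke j))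

  -- k spokes meet E in k distinct vertices, so they meet E everywhere when |E| ≤ k.
  meet-surjective : (vertex : Fin k → V) → (∀ {u} → E u → ∃ λ y → vertex y ≡ u) →
                    ∀ y → ∃ λ i → meet i ≡ vertex y
  meet-surjective vertex enumerates y = i , trans (sym (vertex-index i)) (cong vertex indexᵢ≡y)
    where
    open ≡-Reasoning

    index : Fin k → Fin k
    index i = proj₁ (enumerates (meet∈E i))

    vertex-index : ∀ i → vertex (index i) ≡ meet i
    vertex-index i = proj₂ (enumerates (meet∈E i))

    index-injective : Injective _≡_ _≡_ index
    index-injective {i} {j} eq = meet-injective (begin
      meet i             ≡⟨ vertex-index i ⟨
      vertex (index i)   ≡⟨ cong vertex eq ⟩
      vertex (index j)   ≡⟨ vertex-index j ⟩
      meet j             ∎)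

    i : Fin k
    i = proj₁ (injective⇒surjective index-injective y)

    indexᵢ≡y : index i ≡ y
    indexᵢ≡y = proj₂ (injective⇒surjective index-injective y)

module FanInL {r m n} {Es : Fin (3 + r) → VSet (LVertex m n)} {E : VSet (LVertex m n)}
  {a : Fin m} {xs : Fin (suc r) → Fin m} {b d : Fin n} {p : Fin m} {q : Fin n}
  (Es∈L : ∀ i → L (3 + r) m n (Es i))
  (a<xs : ∀ i → a <ᶠ xs i)
  (d<b : d <ᶠ b)
  (E⇔ : ∀ u → E u ⇔ LEdgeSet (3 + r) a xs b d u)
  (spokes-meet : ∀ i j → i ≢ j → ∀ u → (Es i u × Es j u) ⇔ (u ≡ (p , q)))
  (v∉E : ¬ E (p , q))
  (meets : ∀ i → Σ (LVertex m n) λ w → ∀ u → (Es i u × E u) ⇔ (u ≡ w))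
  where

  open Fan spokes-meet v∉E meets

  vertex : Fin (3 + r) → LVertex m n
  vertex = L-vertex (3 + r) a xs b d

  apex corner next : Fin (3 + r)
  apex   = Fin.zero
  corner = Fin.suc Fin.zero
  next   = Fin.suc (Fin.suc Fin.zero)

  vertex∈E : ∀ y → E (vertex y)
  vertex∈E y = from (E⇔ _) (L-vertex∈LEdgeSet (3 + r) a xs b d y)

  owner : Fin (3 + r) → Fin (3 + r)
  owner y = proj₁ (meet-surjective vertex (LEdgeSet⇒L-vertex (3 + r) a xs b d ∘ to (E⇔ _)) y)

  meet-owner : ∀ y → meet (owner y) ≡ vertex y
  meet-owner y = proj₂ (meet-surjective vertex (LEdgeSet⇒L-vertex (3 + r) a xs b d ∘ to (E⇔ _)) y)

  owner-contains : ∀ y → Es (owner y) (vertex y)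
  owner-contains y = subst (Es (owner y)) (meet-owner y) (meet∈spoke (owner y))

  owned-only : ∀ {y u} → Es (owner y) u → E u → u ≡ vertex y
  owned-only {y} s e = trans (meet-unique s e) (meet-owner y)

  owners-share-only-center : ∀ {y y′ u} → vertex y ≢ vertex y′ →
                             Es (owner y) u → Es (owner y′) u → u ≡ (p , q)
  owners-share-only-center {y} {y′} vertices≢ =
    shared⇒center (λ eq → vertices≢ (trans (sym (meet-owner y)) (trans eq (meet-owner y′))))

  center∈every-spoke : ∀ i → Es i (p , q)
  center∈every-spoke Fin.zero    = center∈spoke {j = Fin.suc Fin.zero} (λ ())
  center∈every-spoke (Fin.suc i) = center∈spoke {j = Fin.zero} (λ ())

  spoke-corner : ∀ i {x y x′ y′} → Es i (x , y) → Es i (x′ , y′) → y <ᶠ y′ →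
                 x′ ≤ᶠ x × Es i (x′ , y)
  spoke-corner i = L-corner {k = 3 + r} (Es∈L i)

  corner≢apex : vertex corner ≢ vertex apex
  corner≢apex = Fin.<⇒≢ d<b ∘ cong proj₂

  corner≢next : vertex corner ≢ vertex next
  corner≢next = Fin.<⇒≢ (a<xs Fin.zero) ∘ cong proj₁

  center-off-base-row : q ≢ d
  center-off-base-row refl = corner≢apex (owned-only corner∈apex-owner (vertex∈E corner))
    where
    corner∈apex-owner : Es (owner apex) (vertex corner)
    corner∈apex-owner = proj₂ (spoke-corner (owner apex) (center∈every-spoke _) (owner-contains apex) d<b)

  center-not-above-base : ¬ d <ᶠ q
  center-not-above-base d<q = Fin.<⇒≢ d<q (cong proj₂
    (owners-share-only-center corner≢next (below (owner-contains corner)) (below (owner-contains next))))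
    where
    below : ∀ {i x} → Es i (x , d) → Es i (p , d)
    below {i} s = proj₂ (spoke-corner i s (center∈every-spoke i) d<q)

  center-not-below-base : ¬ q <ᶠ d
  center-not-below-base q<d = ℕ.<⇒≱ (a<xs Fin.zero) (subst (xs Fin.zero ≤ᶠ_) (sym a≡p) xs₀≤p)
    where
    xs₀≤p : xs Fin.zero ≤ᶠ p
    xs₀≤p = proj₁ (spoke-corner (owner next) (center∈every-spoke _) (owner-contains next) q<d)

    a≡p : a ≡ p
    a≡p = cong proj₁ (owners-share-only-center corner≢apex
      (proj₂ (spoke-corner (owner corner) (center∈every-spoke _) (owner-contains corner) q<d))
      (proj₂ (spoke-corner (owner apex) (center∈every-spoke _) (owner-contains apex) (Fin.<-trans q<d d<b))))

  no-fan : ⊥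
  no-fan with Fin.<-cmp d q
  ... | tri< d<q _ _ = center-not-above-base d<q
  ... | tri≈ _ d≡q _ = center-off-base-row (sym d≡q)
  ... | tri> _ _ q<d = center-not-below-base q<d

-- The bounds m, n ≥ 2 only ensure that L_{m,n} has edges at all.
proposition5p1 : (k m n : ℕ) → 3 ≤ k → 2 ≤ m → 2 ≤ n → FanFree k (L k m n)
proposition5p1 0               _ _ ()
proposition5p1 1               _ _ (s≤s ())
proposition5p1 2               _ _ (s≤s (s≤s ()))
proposition5p1 (suc (suc (suc r))) m n _ _ _
  (Es , E , (p , q) , Es∈L , (a , xs , b , d , a<xs , _ , d<b , E⇔) , spokes-meet , v∉E , meets) =
  FanInL.no-fan Es∈L a<xs d<b E⇔ spokes-meet v∉E meets
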